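{- Let $\Pi:\varphi$ be a DQBF and $C$ a clause compatible with it. Suppose $C$ has property DQAT with respect to $\Pi:\varphi$, i.e. $\mathrm{abs}(\Pi:\varphi\land\neg C,\mathrm{dep}(C))\vdash_{1\forall}\bot$. Then $\Pi:\varphi$ and $\Pi:\varphi\land C$ are equivalent.
   Context: A DQBF over a finite set $V=\{x_1,\dots,x_n,y_1,\dots,y_m\}$ of Boolean variables has the form $\forall x_1\ldots\forall x_n\exists y_1(D_{y_1})\ldots\exists y_m(D_{y_m}):\varphi$, where $D_{y_i}\subseteq\{x_1,\dots,x_n\}$ is the dependency set of $y_i$ and the matrix $\varphi$ is a CNF, treated as a set of clauses, each clause a set of literals. The prefix is treated as a set $\Pi$. $V_\exists$ and $V_\forall$ denote the existential and universal variables. A clause is compatible if it contains only variables of the DQBF. For a set $X$ of variables, $\mathcal{A}(X)$ is the set of assignments $X\to\{0,1\}$. A Skolem function is a family $(s_y)_{y\in V_\exists}$ with $s_y:\mathcal{A}(D_y)\to\{0,1\}$ such that substituting $s_y$ for each $y$ makes the matrix a tautology. Two DQBFs over the same existential and universal variables are equivalent iff they have exactly the same Skolem functions. Dependencies are defined by $\mathrm{dep}(v)=\{v\}$ if $v$ is universal and $\mathrm{dep}(v)=D_v$ if $v$ is existential. For a clause, $\mathrm{dep}(C)=\bigcup_{\ell\in C}\mathrm{dep}(\mathrm{var}(\ell))$. $\Pi:\varphi\land C$ adds clause $C$. $\Pi:\varphi\land\neg C$ adds the unit clauses $\{\neg\ell\}$ for all $\ell\in C$. Abstraction: for $V'\subseteq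 V_\forall$, $\mathrm{abs}(\Pi:\varphi,V')$ keeps the matrix and turns each $v\in V'$ into an existential variable $\exists v(\emptyset)$, removing $v$ from all dependency sets. Universal reduction: $\mathrm{UR}(C)$ removes from a non-tautological clause $C$ every universal literal $\ell$ for which no existential literal $k\in C$ has $\mathrm{var}(\ell)\in D_{\mathrm{var}(k)}$. $\mathrm{UR}$ is applied clause-wise to formulas. Unit propagation: with $U$ the set of existential literals $\ell$ with $\{\ell\}\in\varphi$, define $\mathrm{UP}^1(\Pi:\varphi)=\mathrm{UR}\bigl(\Pi\setminus\{\mathrm{var}(\ell)\mid\ell\in U\}:\{C\setminus\{\neg\ell\mid\ell\in U\}\mid C\in\varphi,\ C\cap U=\emptyset\}\bigr)$. Iterate to a fixpoint. $\Pi:\varphi\vdash_{1\forall}\bot$ means the fixpoint contains the empty clause. -}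

module Defs where

open import Data.Nat using (ℕ; _≡ᵇ_)
open import Data.Bool using (Bool; true; false; not; _∧_; _∨_; if_then_else_)
open import Data.List using (List; []; _∷_; map; concat; concatMap; null; filterᵇ; _++_)
open import Data.Bool.ListAction using (any; all)
open import Data.List.Relation.Unary.All using (All; []; _∷_)
open import Data.List.Relation.Unary.Unique.Propositional using (Unique)
open import Data.List.Membership.Propositional using (_∈_)
open import Data.Product using (_×_; _,_; proj₁; proj₂; ∃-syntax)
open import Function using (_∘_)
open import Relation.Binary.PropositionalEquality using (_≡_)
open import Relation.Nullary using (¬_)

-- Syntax.  Variables are natural numbers.  A literal is a variable with
-- a polarity (true = positive).  Clauses and CNFs are lists, read with
-- set semantics (membership).

Var : Set
Var = ℕ

Lit : Set
Lit = Var × Bool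

var : Lit → Var
var = proj₁

neg : Lit → Lit
neg (v , b) = (v , not b)

boolEq : Bool → Bool → Bool
boolEq true  b = b
boolEq false b = not b

litEq : Lit → Lit → Bool
litEq (v , b) (w , c) = (v ≡ᵇ w) ∧ boolEq b c

Clause : Set
Clause = List Lit

CNF : Set
CNF = List Clause

_∈ᵇ_ : Var → List Var → Bool
x ∈ᵇ xs = any (x ≡ᵇ_) xs

record Prefix : Set where
  constructor mkPrefix
  field
    univ  : List Var
    exist : List (Var × List Var)
open Prefix public

vars : Prefix → List Var
vars Π = univ Π ++ map proj₁ (exist Π)

record WellFormed (Π : Prefix) (φ : CNF) : Set where
  field
    univUnique  : Unique (univ Π)
    existUnique : Unique (map proj₁ (exist Π))
    disjoint    : ∀ {v} → v ∈ univ Π → ¬ (v ∈ map proj₁ (exist Π))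
    depsUniv    : All (λ e → ∀ {x} → x ∈ proj₂ e → x ∈ univ Π) (exist Π)
    depsUnique  : All (λ e → Unique (proj₂ e)) (exist Π)
    matrixOver  : ∀ {C ℓ} → C ∈ φ → ℓ ∈ C → var ℓ ∈ vars Π

Compatible : Prefix → Clause → Set
Compatible Π C = ∀ {ℓ} → ℓ ∈ C → var ℓ ∈ vars Π

Assign : List Var → Set
Assign D = All (λ _ → Bool) D

restrict : (D : List Var) → (Var → Bool) → Assign D
restrict []      α = []
restrict (x ∷ D) α = α x ∷ restrict D α

SkolemFam : Prefix → Set
SkolemFam Π = All (λ e → Assign (proj₂ e) → Bool) (exist Π)

extend : (es : List (Var × List Var)) → All (λ e → Assign (proj₂ e) → Bool) es
       → (Var → Bool) → Var → Bool
extend []             []       α v = α v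
extend ((y , D) ∷ es) (f ∷ fs) α v =
  if v ≡ᵇ y then f (restrict D α) else extend es fs α v

evalLit : (Var → Bool) → Lit → Bool
evalLit σ (v , b) = boolEq (σ v) b

evalCNF : (Var → Bool) → CNF → Bool
evalCNF σ φ = all (any (evalLit σ)) φ

IsSkolem : (Π : Prefix) → CNF → SkolemFam Π → Set
IsSkolem Π φ s = ∀ (α : Var → Bool) → evalCNF (extend (exist Π) s α) φ ≡ true

record Equivalent (Π : Prefix) (φ ψ : CNF) : Set where
  field
    to   : ∀ s → IsSkolem Π φ s → IsSkolem Π ψ s
    from : ∀ s → IsSkolem Π ψ s → IsSkolem Π φ s

isUniv : Prefix → Var → Bool
isUniv Π v = v ∈ᵇ univ Π

isExist : Prefix → Var → Bool
isExist Π v = v ∈ᵇ map proj₁ (exist Π)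

lookupDeps : List (Var × List Var) → Var → List Var
lookupDeps []             v = []
lookupDeps ((y , D) ∷ es) v = if v ≡ᵇ y then D else lookupDeps es v

depVar : Prefix → Var → List Var
depVar Π v = if isUniv Π v then v ∷ [] else lookupDeps (exist Π) v

depClause : Prefix → Clause → List Var
depClause Π C = concatMap (depVar Π ∘ var) C

negClause : Clause → CNF
negClause C = map (λ ℓ → neg ℓ ∷ []) C

absPrefix : Prefix → List Var → Prefix
absPrefix Π V' = mkPrefix
  (filterᵇ (λ v → not (v ∈ᵇ V')) (univ Π))
  (map (λ e → (proj₁ e , filterᵇ (λ v → not (v ∈ᵇ V')) (proj₂ e))) (exist Π)
    ++ map (λ v → (v , [])) (filterᵇ (_∈ᵇ V') (univ Π)))

isTautology : Clause → Bool
isTautology C = any (λ ℓ → any (litEq (neg ℓ)) C) C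

URClause : Prefix → Clause → Clause
URClause Π C =
  if isTautology C then C
  else filterᵇ (λ ℓ → not (isUniv Π (var ℓ)
                     ∧ not (any (λ k → isExist Π (var k)
                                     ∧ (var ℓ ∈ᵇ lookupDeps (exist Π) (var k))) C)))
               C

UR : Prefix → CNF → CNF
UR Π φ = map (URClause Π) φ

isUnitOf : Lit → Clause → Bool
isUnitOf ℓ C = not (null C) ∧ all (litEq ℓ) C

unitLits : Prefix → CNF → List Lit
unitLits Π φ = filterᵇ (λ ℓ → isExist Π (var ℓ) ∧ any (isUnitOf ℓ) φ) (concat φ)

inLits : Lit → List Lit → Bool
inLits ℓ U = any (litEq ℓ) U

UP1 : Prefix × CNF → Prefix × CNF
UP1 (Π , φ) =
  let U  = unitLits Π φ
      Π' = mkPrefix (univ Π)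
                    (filterᵇ (λ e → not (proj₁ e ∈ᵇ map var U)) (exist Π))
      φ' = map (filterᵇ (λ k → not (inLits (neg k) U)))
               (filterᵇ (λ C → not (any (λ k → inLits k U) C)) φ)
  in (Π' , UR Π' φ')

UPiter : ℕ → Prefix × CNF → Prefix × CNF
UPiter ℕ.zero    F = F
UPiter (ℕ.suc k) F = UPiter k (UP1 F)

hasEmptyClause : CNF → Bool
hasEmptyClause φ = any null φ

-- Π : φ ⊢_{1∀} ⊥ : the unit-propagation fixpoint contains the empty clause.
-- (Once the empty clause appears it persists, and the iteration reaches
-- its fixpoint after finitely many steps, so this is "some iterate
-- contains the empty clause".)
Refutes1∀ : Prefix → CNF → Set
Refutes1∀ Π φ = ∃[ k ] (hasEmptyClause (proj₂ (UPiter k (Π , φ))) ≡ true)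

DQAT : Prefix → CNF → Clause → Set
DQAT Π φ C = Refutes1∀ (absPrefix Π (depClause Π C)) (φ ++ negClause C)

module Submission where

-- Every Skolem function s of Π : φ satisfies C.  Otherwise some universal assignment α₀
-- falsifies C under s, and pinning the variables of dep(C) to their α₀-values turns s into
-- Skolem functions of abs(Π : φ ∧ ¬C, dep(C)): the abstracted universals become the constants
-- α₀, every existential keeps its function with the pinned arguments filled in, and C, whose
-- literals depend only on dep(C), stays false.  This contradicts the refutation, because unit
-- propagation with universal reduction preserves the existence of Skolem functions (setting
-- reducible universals so as to falsify their literals shows that a reduced clause is still
-- satisfied), and no formula with Skolem functions contains the empty clause.  The converse
-- inclusion is immediate.

open import Data.Bool using (Bool; true; false; not; _∧_; T; if_then_else_)
open import Data.Bool.ListAction using (any; all)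
open import Data.Bool.Properties using (T-≡; ¬-not; not-injective; ∧-zeroʳ)
open import Data.List using (List; []; _∷_; map; concat; filterᵇ; _++_; null)
open import Data.List.Membership.Propositional using (_∈_; find; lose)
open import Data.List.Membership.Propositional.Properties
  using (∈-++⁻; ∈-++⁺ˡ; ∈-map⁺; ∈-map⁻; ∈-filter⁺; ∈-filter⁻; ∈-concatMap⁺; ∈-concatMap⁻)
open import Data.List.Properties using (map-∘)
open import Data.List.Relation.Binary.Subset.Propositional.Properties using (map⁺; filter-⊆)
open import Data.List.Relation.Unary.All as All using (All; []; _∷_)
open import Data.List.Relation.Unary.All.Properties using (all⁺; all⁻; ++⁺)
open import Data.List.Relation.Unary.Any using (here; there)
open import Data.List.Relation.Unary.Any.Properties using (any⁺; any⁻)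
open import Data.Nat using (ℕ; _≡ᵇ_)
open import Data.Nat.Properties using (≡ᵇ⇒≡; ≡⇒≡ᵇ)
open import Data.Product using (Σ; _×_; _,_; proj₁; proj₂; ∃-syntax)
open import Data.Sum using (_⊎_; inj₁; inj₂)
open import Function using (_∘_; case_of_; Equivalence)
open import Relation.Binary.PropositionalEquality
open import Relation.Nullary using (¬_; contradiction)
open import Relation.Nullary.Decidable using (T?)

open import Defs

≡true⇒T : ∀ {b} → b ≡ true → T b
≡true⇒T = Equivalence.from T-≡

T⇒≡true : ∀ {b} → T b → b ≡ true
T⇒≡true = Equivalence.to T-≡

true≡false-elim : ∀ {b} {A : Set} → b ≡ true → b ≡ false → A
true≡false-elim refl ()

∧-true⁻ : ∀ {a b} → a ∧ b ≡ true → a ≡ true × b ≡ true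
∧-true⁻ {true} b≡true = refl , b≡true

module _ {A : Set} (p : A → Bool) where

  any-true⁺ : ∀ {x xs} → x ∈ xs → p x ≡ true → any p xs ≡ true
  any-true⁺ x∈xs px = T⇒≡true (any⁺ p (lose x∈xs (≡true⇒T px)))

  any-true⁻ : ∀ xs → any p xs ≡ true → ∃[ x ] x ∈ xs × p x ≡ true
  any-true⁻ xs e with x , x∈xs , px ← find (any⁻ p xs (≡true⇒T e)) =
    x , x∈xs , T⇒≡true px

  any-false⁻ : ∀ {x xs} → any p xs ≡ false → x ∈ xs → p x ≡ false
  any-false⁻ e x∈xs = ¬-not λ px → true≡false-elim (any-true⁺ x∈xs px) e

  all-true⁺ : ∀ xs → (∀ {x} → x ∈ xs → p x ≡ true) → all p xs ≡ true
  all-true⁺ xs h = T⇒≡true (all⁻ p (All.tabulate (≡true⇒T ∘ h)))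

  all-true⁻ : ∀ {x xs} → all p xs ≡ true → x ∈ xs → p x ≡ true
  all-true⁻ {xs = xs} e x∈xs = T⇒≡true (All.lookup (all⁺ p xs (≡true⇒T e)) x∈xs)

  ∈-filterᵇ⁺ : ∀ {x xs} → x ∈ xs → p x ≡ true → x ∈ filterᵇ p xs
  ∈-filterᵇ⁺ x∈xs px = ∈-filter⁺ (T? ∘ p) x∈xs (≡true⇒T px)

  ∈-filterᵇ⁻ : ∀ {x} xs → x ∈ filterᵇ p xs → x ∈ xs × p x ≡ true
  ∈-filterᵇ⁻ xs x∈ with x∈xs , px ← ∈-filter⁻ (T? ∘ p) {xs = xs} x∈ = x∈xs , T⇒≡true px

≡ᵇ-refl : ∀ n → (n ≡ᵇ n) ≡ true
≡ᵇ-refl n = T⇒≡true (≡⇒≡ᵇ n n refl)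

≡ᵇ-sound : ∀ {m n} → (m ≡ᵇ n) ≡ true → m ≡ n
≡ᵇ-sound {m} {n} e = ≡ᵇ⇒≡ m n (≡true⇒T e)

∈ᵇ⇒∈ : ∀ {x xs} → x ∈ᵇ xs ≡ true → x ∈ xs
∈ᵇ⇒∈ {x} {xs} e with y , y∈xs , x≡ᵇy ← any-true⁻ (x ≡ᵇ_) xs e =
  subst (_∈ xs) (sym (≡ᵇ-sound x≡ᵇy)) y∈xs

∈⇒∈ᵇ : ∀ {x xs} → x ∈ xs → x ∈ᵇ xs ≡ true
∈⇒∈ᵇ {x} x∈xs = any-true⁺ (x ≡ᵇ_) x∈xs (≡ᵇ-refl x)

litEq-refl : ∀ ℓ → litEq ℓ ℓ ≡ true
litEq-refl (v , true)  rewrite ≡ᵇ-refl v = refl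
litEq-refl (v , false) rewrite ≡ᵇ-refl v = refl

litEq-sound : ∀ ℓ k → litEq ℓ k ≡ true → ℓ ≡ k
litEq-sound (v , b) (w , c) e with v ≡ᵇ w in v≡ᵇw
litEq-sound (v , true)  (w , true)  e | true = cong (_, true) (≡ᵇ-sound v≡ᵇw)
litEq-sound (v , false) (w , false) e | true = cong (_, false) (≡ᵇ-sound v≡ᵇw)

inLits-true⁺ : ∀ {ℓ U} → ℓ ∈ U → inLits ℓ U ≡ true
inLits-true⁺ {ℓ} ℓ∈U = any-true⁺ (litEq ℓ) ℓ∈U (litEq-refl ℓ)

inLits-true⁻ : ∀ ℓ U → inLits ℓ U ≡ true → ℓ ∈ U
inLits-true⁻ ℓ U e with k , k∈U , ℓ≡k ← any-true⁻ (litEq ℓ) U e =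
  subst (_∈ U) (sym (litEq-sound ℓ k ℓ≡k)) k∈U

var-≡⇒≡⊎≡neg : ∀ k ℓ → var k ≡ var ℓ → ℓ ≡ k ⊎ ℓ ≡ neg k
var-≡⇒≡⊎≡neg (v , true)  (v , true)  refl = inj₁ refl
var-≡⇒≡⊎≡neg (v , false) (v , false) refl = inj₁ refl
var-≡⇒≡⊎≡neg (v , true)  (v , false) refl = inj₂ refl
var-≡⇒≡⊎≡neg (v , false) (v , true)  refl = inj₂ refl

evalLit-neg : ∀ σ ℓ → evalLit σ (neg ℓ) ≡ not (evalLit σ ℓ)
evalLit-neg σ (v , b) with σ v
... | true  = refl
... | false with b
...   | true  = refl
...   | false = refl

evalLit-cong : ∀ σ τ ℓ → σ (var ℓ) ≡ τ (var ℓ) → evalLit σ ℓ ≡ evalLit τ ℓ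
evalLit-cong σ τ (v , b) eq = cong (λ x → boolEq x b) eq

isTautology-complementary : ∀ {ℓ D} → ℓ ∈ D → neg ℓ ∈ D → isTautology D ≡ true
isTautology-complementary {ℓ} {D} ℓ∈D ¬ℓ∈D =
  any-true⁺ (λ k → inLits (neg k) D) ℓ∈D (inLits-true⁺ ¬ℓ∈D)

_⊨_ : (Var → Bool) → Clause → Set
σ ⊨ D = any (evalLit σ) D ≡ true

⊨-cong : ∀ {σ τ} → (∀ v → σ v ≡ τ v) → ∀ D → σ ⊨ D → τ ⊨ D
⊨-cong {σ} {τ} σ≗τ D sat with k , k∈D , k-true ← any-true⁻ (evalLit σ) D sat =
  any-true⁺ (evalLit τ) k∈D (trans (sym (evalLit-cong σ τ k (σ≗τ (var k)))) k-true)

patch : (Var → Bool) → (Var → Bool) → (Var → Bool) → Var → Bool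
patch R p α w = if R w then p w else α w

patch-true : ∀ R p α {w} → R w ≡ true → patch R p α w ≡ p w
patch-true R p α e rewrite e = refl

patch-false : ∀ R p α {w} → R w ≡ false → patch R p α w ≡ α w
patch-false R p α e rewrite e = refl

SkolemFns : List (Var × List Var) → Set
SkolemFns es = All (λ e → Assign (proj₂ e) → Bool) es

extend-nonexist : ∀ es (fs : SkolemFns es) α v
  → v ∈ᵇ map proj₁ es ≡ false → extend es fs α v ≡ α v
extend-nonexist []             []       α v v∉es = refl
extend-nonexist ((y , D) ∷ es) (f ∷ fs) α v v∉es with v ≡ᵇ y
... | false = extend-nonexist es fs α v v∉es

restrict-cong : ∀ D {α β} → (∀ {w} → w ∈ D → α w ≡ β w) → restrict D α ≡ restrict D β
restrict-cong []      α≗β = refl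
restrict-cong (x ∷ D) α≗β = cong₂ _∷_ (α≗β (here refl)) (restrict-cong D (α≗β ∘ there))

extend-cong : ∀ es (fs : SkolemFns es) {α β} v
  → (v ∈ᵇ map proj₁ es ≡ true → ∀ {w} → w ∈ lookupDeps es v → α w ≡ β w)
  → (v ∈ᵇ map proj₁ es ≡ false → α v ≡ β v)
  → extend es fs α v ≡ extend es fs β v
extend-cong []             []       v onDeps onSelf = onSelf refl
extend-cong ((y , D) ∷ es) (f ∷ fs) v onDeps onSelf with v ≡ᵇ y
... | true  = cong f (restrict-cong D (onDeps refl))
... | false = extend-cong es fs v onDeps onSelf

filterFns : ∀ (g : Var → Bool) {es} → SkolemFns es → SkolemFns (filterᵇ (g ∘ proj₁) es)
filterFns g {[]}           []       = []
filterFns g {(y , D) ∷ es} (f ∷ fs) with g y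
... | true  = f ∷ filterFns g fs
... | false = filterFns g fs

extend-filterFns : ∀ (g : Var → Bool) es (fs : SkolemFns es) α v → g v ≡ true
  → extend (filterᵇ (g ∘ proj₁) es) (filterFns g fs) α v ≡ extend es fs α v
extend-filterFns g []             []       α v gv = refl
extend-filterFns g ((y , D) ∷ es) (f ∷ fs) α v gv with g y in gy
... | true with v ≡ᵇ y
...   | true  = refl
...   | false = extend-filterFns g es fs α v gv
extend-filterFns g ((y , D) ∷ es) (f ∷ fs) α v gv | false with v ≡ᵇ y in v≡ᵇy
... | false = extend-filterFns g es fs α v gv
... | true  = true≡false-elim gv (subst (λ x → g x ≡ false) (sym (≡ᵇ-sound v≡ᵇy)) gy)

extend-++⁺-in : ∀ es {rest} (fs : SkolemFns es) (t : SkolemFns rest) α v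
  → v ∈ᵇ map proj₁ es ≡ true → extend (es ++ rest) (++⁺ fs t) α v ≡ extend es fs α v
extend-++⁺-in ((y , D) ∷ es) (f ∷ fs) t α v v∈es with v ≡ᵇ y
... | true  = refl
... | false = extend-++⁺-in es fs t α v v∈es

extend-++⁺-out : ∀ es {rest} (fs : SkolemFns es) (t : SkolemFns rest) α v
  → v ∈ᵇ map proj₁ es ≡ false → extend (es ++ rest) (++⁺ fs t) α v ≡ extend rest t α v
extend-++⁺-out []             []       t α v v∉es = refl
extend-++⁺-out ((y , D) ∷ es) (f ∷ fs) t α v v∉es with v ≡ᵇ y
... | false = extend-++⁺-out es fs t α v v∉es

IsSkolem⁺ : ∀ Π φ {s}
  → (∀ {D} → D ∈ φ → ∀ α → extend (exist Π) s α ⊨ D) → IsSkolem Π φ s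
IsSkolem⁺ Π φ {s} h α = all-true⁺ _ φ λ D∈φ → h D∈φ α

IsSkolem⁻ : ∀ Π φ {s}
  → IsSkolem Π φ s → ∀ {D} → D ∈ φ → ∀ α → extend (exist Π) s α ⊨ D
IsSkolem⁻ Π φ sk D∈φ α = all-true⁻ _ (sk α) D∈φ

HasSkolem : Prefix × CNF → Set
HasSkolem (Π , φ) = Σ (SkolemFam Π) (IsSkolem Π φ)

hasSkolem⇒¬hasEmptyClause : ∀ F → HasSkolem F → ¬ hasEmptyClause (proj₂ F) ≡ true
hasSkolem⇒¬hasEmptyClause (Π , φ) (s , sk) e with any-true⁻ null φ e
... | [] , []∈φ , _ = true≡false-elim (IsSkolem⁻ Π φ sk []∈φ (λ _ → false)) refl

Disjoint : Prefix → Set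
Disjoint Π = ∀ {v} → v ∈ univ Π → ¬ v ∈ map proj₁ (exist Π)

Disjoint⇒isExist-false : ∀ {Π v} → Disjoint Π → isUniv Π v ≡ true → isExist Π v ≡ false
Disjoint⇒isExist-false {Π} {v} disj v-univ =
  ¬-not λ v-exist → disj (∈ᵇ⇒∈ {v} v-univ) (∈ᵇ⇒∈ {v} v-exist)

falsifier : Clause → Var → Bool
falsifier []            v = false
falsifier ((w , c) ∷ D) v = if v ≡ᵇ w then not c else falsifier D v

falsifier-occurs : ∀ D {v b} → (v , b) ∈ D → ∃[ c ] (v , c) ∈ D × falsifier D v ≡ not c
falsifier-occurs ((w , c) ∷ D) {v} vb∈ with v ≡ᵇ w in v≡ᵇw | vb∈
... | true  | _          = c , here (cong (_, c) (≡ᵇ-sound v≡ᵇw)) , refl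
... | false | here refl  = true≡false-elim (≡ᵇ-refl v) v≡ᵇw
... | false | there vb∈D with c′ , vc′∈D , eq ← falsifier-occurs D vb∈D = c′ , there vc′∈D , eq

falsifier-falsifies : ∀ {D v b}
  → isTautology D ≡ false → (v , b) ∈ D → boolEq (falsifier D v) b ≡ false
falsifier-falsifies {D} {v} {b} taut vb∈D
  with c , vc∈D , fv ← falsifier-occurs D vb∈D rewrite fv with b | c
... | true  | true  = refl
... | false | false = refl
... | true  | false = true≡false-elim (isTautology-complementary vc∈D vb∈D) taut
... | false | true  = true≡false-elim (isTautology-complementary vc∈D vb∈D) taut

-- A literal removed by universal reduction can be made false by choosing its universal
-- variable freely, and that choice changes no literal the reduction keeps.
URClause-sound : ∀ Π → Disjoint Π → (s : SkolemFam Π) (D : Clause)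
  → (∀ α → extend (exist Π) s α ⊨ D) → ∀ α → extend (exist Π) s α ⊨ URClause Π D
URClause-sound Π disj s D satD α with isTautology D in taut
... | true  = satD α
... | false = satReduced
  where
    es = exist Π

    hasDependent : Var → Bool
    hasDependent w = any (λ k → isExist Π (var k) ∧ (w ∈ᵇ lookupDeps es (var k))) D

    reducible : Var → Bool
    reducible w = isUniv Π w ∧ not (hasDependent w)

    β : Var → Bool
    β = patch reducible (falsifier D) α

    reduced-false : ∀ {v b} → (v , b) ∈ D → reducible v ≡ true
      → evalLit (extend es s β) (v , b) ≡ false
    reduced-false {v} {b} vb∈D red =
      trans (cong (λ x → boolEq x b) β-at-v) (falsifier-falsifies taut vb∈D)
      where
        β-at-v : extend es s β v ≡ falsifier D v
        β-at-v = trans (extend-nonexist es s β v (Disjoint⇒isExist-false {Π} {v} disj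
                                                    (proj₁ (∧-true⁻ red))))
                       (patch-true reducible (falsifier D) α red)

    kept-agrees : ∀ {v b} → (v , b) ∈ D → reducible v ≡ false
      → extend es s α v ≡ extend es s β v
    kept-agrees {v} vb∈D irred =
      extend-cong es s v onDeps (λ _ → sym (patch-false reducible (falsifier D) α irred))
      where
        onDeps : isExist Π v ≡ true → ∀ {w} → w ∈ lookupDeps es v → α w ≡ β w
        onDeps v-exist {w} w∈deps = sym (patch-false reducible (falsifier D) α irreducible)
          where
            dependent : hasDependent w ≡ true
            dependent = any-true⁺ _ vb∈D (cong₂ _∧_ v-exist (∈⇒∈ᵇ w∈deps))

            irreducible : reducible w ≡ false
            irreducible = trans (cong (λ x → isUniv Π w ∧ not x) dependent) (∧-zeroʳ (isUniv Π w))

    satReduced : extend es s α ⊨ filterᵇ (λ ℓ → not (reducible (var ℓ))) D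
    satReduced with (v , b) , vb∈D , vb-true ← any-true⁻ _ D (satD β) | reducible v in red
    ... | true  = true≡false-elim vb-true (reduced-false vb∈D red)
    ... | false = any-true⁺ _ (∈-filterᵇ⁺ _ vb∈D (cong not red))
                    (trans (cong (λ x → boolEq x b) (kept-agrees vb∈D red)) vb-true)

module UnitPropagation (Π : Prefix) (φ : CNF) (s : SkolemFam Π) (sk : IsSkolem Π φ s) where

  U : List Lit
  U = unitLits Π φ

  keep : Var → Bool
  keep v = not (v ∈ᵇ map var U)

  Π′ : Prefix
  Π′ = mkPrefix (univ Π) (filterᵇ (keep ∘ proj₁) (exist Π))

  s′ : SkolemFam Π′
  s′ = filterFns keep s

  dropFalsified : Clause → Clause
  dropFalsified = filterᵇ (λ k → not (inLits (neg k) U))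

  module _ (α : Var → Bool) where

    σ : Var → Bool
    σ = extend (exist Π) s α

    unitLit-true : ∀ {ℓ} → ℓ ∈ U → evalLit σ ℓ ≡ true
    unitLit-true {ℓ} ℓ∈U
      with _ , ℓ-unit ← ∧-true⁻ (proj₂ (∈-filterᵇ⁻ _ (concat φ) ℓ∈U))
      with D , D∈φ , D-unit ← any-true⁻ (isUnitOf ℓ) φ ℓ-unit
      with k , k∈D , k-true ← any-true⁻ _ D (IsSkolem⁻ Π φ sk D∈φ α)
      = subst (λ x → evalLit σ x ≡ true) (sym ℓ≡k) k-true
      where
        ℓ≡k : ℓ ≡ k
        ℓ≡k = litEq-sound ℓ k (all-true⁻ _ (proj₂ (∧-true⁻ D-unit)) k∈D)

    neg-trueLit-∉U : ∀ {k} → evalLit σ k ≡ true → inLits (neg k) U ≡ false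
    neg-trueLit-∉U {k} k-true = ¬-not λ ¬k∈U →
      true≡false-elim (unitLit-true (inLits-true⁻ (neg k) U ¬k∈U))
                      (trans (evalLit-neg σ k) (cong not k-true))

    trueLit-kept : ∀ {k} → evalLit σ k ≡ true → inLits k U ≡ false → keep (var k) ≡ true
    trueLit-kept {k} k-true k∉U = cong not (¬-not λ var∈ → clash (∈-map⁻ var (∈ᵇ⇒∈ {var k} var∈)))
      where
        clash : ¬ (∃[ ℓ ] ℓ ∈ U × var k ≡ var ℓ)
        clash (ℓ , ℓ∈U , same) with var-≡⇒≡⊎≡neg k ℓ same
        ... | inj₁ refl = true≡false-elim (inLits-true⁺ ℓ∈U) k∉U
        ... | inj₂ refl = true≡false-elim (inLits-true⁺ ℓ∈U) (neg-trueLit-∉U k-true)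

    reducedClause-sat : ∀ {D} → D ∈ φ → any (λ k → inLits k U) D ≡ false
      → extend (exist Π′) s′ α ⊨ dropFalsified D
    reducedClause-sat {D} D∈φ avoidsU
      with (v , b) , k∈D , k-true ← any-true⁻ (evalLit σ) D (IsSkolem⁻ Π φ sk D∈φ α)
      = any-true⁺ _ (∈-filterᵇ⁺ _ k∈D (cong not (neg-trueLit-∉U k-true)))
          (trans (cong (λ x → boolEq x b) kept-value) k-true)
      where
        kept-value : extend (exist Π′) s′ α v ≡ σ v
        kept-value = extend-filterFns keep (exist Π) s α v
                       (trueLit-kept k-true (any-false⁻ _ avoidsU k∈D))

UP1-sound : ∀ Π φ → Disjoint Π → HasSkolem (Π , φ)
  → Disjoint (proj₁ (UP1 (Π , φ))) × HasSkolem (UP1 (Π , φ))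
UP1-sound Π φ disj (s , sk) = disj′ , s′ , IsSkolem⁺ Π′ (proj₂ (UP1 (Π , φ))) satUR
  where
    open UnitPropagation Π φ s sk

    disj′ : Disjoint Π′
    disj′ v∈univ v∈names′ =
      disj v∈univ (map⁺ proj₁ (filter-⊆ (T? ∘ keep ∘ proj₁) (exist Π)) v∈names′)

    satUR : ∀ {D} → D ∈ proj₂ (UP1 (Π , φ)) → ∀ α → extend (exist Π′) s′ α ⊨ D
    satUR D∈ α
      with D₀ , D₀∈ , refl ← ∈-map⁻ (URClause Π′) D∈
      with D₁ , D₁∈ , refl ← ∈-map⁻ dropFalsified D₀∈
      with D₁∈φ , avoidsU ← ∈-filterᵇ⁻ _ φ D₁∈
      = URClause-sound Π′ disj′ s′ (dropFalsified D₁)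
          (λ β → reducedClause-sat β D₁∈φ (not-injective avoidsU)) α

UPiter-sound : ∀ k F → Disjoint (proj₁ F) → HasSkolem F → HasSkolem (UPiter k F)
UPiter-sound ℕ.zero    F       disj sat = sat
UPiter-sound (ℕ.suc k) (Π , φ) disj sat with disj′ , sat′ ← UP1-sound Π φ disj sat =
  UPiter-sound k (UP1 (Π , φ)) disj′ sat′

Refutes1∀⇒¬HasSkolem : ∀ Π φ → Disjoint Π → Refutes1∀ Π φ → ¬ HasSkolem (Π , φ)
Refutes1∀⇒¬HasSkolem Π φ disj (k , hasEmpty) sat =
  hasSkolem⇒¬hasEmptyClause (UPiter k (Π , φ)) (UPiter-sound k (Π , φ) disj sat) hasEmpty

fromAssign : (D : List Var) → Assign D → Var → Bool
fromAssign []      []       v = false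
fromAssign (x ∷ D) (a ∷ as) v = if v ≡ᵇ x then a else fromAssign D as v

fromAssign-restrict : ∀ D β {w} → w ∈ D → fromAssign D (restrict D β) w ≡ β w
fromAssign-restrict (x ∷ D) β {w} w∈ with w ≡ᵇ x in w≡ᵇx | w∈
... | true  | _         = cong β (sym (≡ᵇ-sound w≡ᵇx))
... | false | here refl = true≡false-elim (≡ᵇ-refl w) w≡ᵇx
... | false | there w∈D = fromAssign-restrict D β w∈D

lookupDeps-⊆ : ∀ {us} es → All (λ e → ∀ {x} → x ∈ proj₂ e → x ∈ us) es
  → ∀ {v w} → w ∈ lookupDeps es v → w ∈ us
lookupDeps-⊆ ((y , D) ∷ es) (D⊆us ∷ es⊆us) {v} w∈ with v ≡ᵇ y
... | true  = D⊆us w∈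
... | false = lookupDeps-⊆ es es⊆us w∈

depVar-⊆-univ : ∀ Π φ → WellFormed Π φ → ∀ {v w} → w ∈ depVar Π v → w ∈ univ Π
depVar-⊆-univ Π φ wf {v} w∈ with isUniv Π v in v-univ | w∈
... | true  | here refl = ∈ᵇ⇒∈ {v} v-univ
... | false | w∈deps    = lookupDeps-⊆ (exist Π) (WellFormed.depsUniv wf) w∈deps

lookupDeps-⊆-depVar : ∀ Π {v w} → Disjoint Π → isExist Π v ≡ true
  → w ∈ lookupDeps (exist Π) v → w ∈ depVar Π v
lookupDeps-⊆-depVar Π {v} disj v-exist w∈ with isUniv Π v in v-univ
... | true  = contradiction (∈ᵇ⇒∈ {v} v-exist) (disj (∈ᵇ⇒∈ {v} v-univ))
... | false = w∈

self-∈-depVar : ∀ Π {v} → v ∈ univ Π → v ∈ depVar Π v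
self-∈-depVar Π v∈ rewrite ∈⇒∈ᵇ v∈ = here refl

module Abstraction (Π : Prefix) (φ : CNF) (C : Clause) (wf : WellFormed Π φ) (α₀ : Var → Bool)
  where

  V′ : List Var
  V′ = depClause Π C

  free : Var → Bool
  free v = not (v ∈ᵇ V′)

  pin : (Var → Bool) → Var → Bool
  pin = patch (_∈ᵇ V′) α₀

  pinned : List Var
  pinned = filterᵇ (_∈ᵇ V′) (univ Π)

  Πₐ : Prefix
  Πₐ = absPrefix Π V′

  abstractEntry : Var × List Var → Var × List Var
  abstractEntry e = (proj₁ e , filterᵇ free (proj₂ e))

  abstractFns : ∀ es → SkolemFns es → SkolemFns (map abstractEntry es)
  abstractFns []             []       = []
  abstractFns ((y , D) ∷ es) (f ∷ fs) =
    (λ a → f (restrict D (pin (fromAssign (filterᵇ free D) a)))) ∷ abstractFns es fs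

  constFns : ∀ ws → SkolemFns (map (λ v → (v , [])) ws)
  constFns []       = []
  constFns (u ∷ ws) = (λ _ → α₀ u) ∷ constFns ws

  abstractSkolem : SkolemFam Π → SkolemFam Πₐ
  abstractSkolem s = ++⁺ (abstractFns (exist Π) s) (constFns pinned)

  extend-abstractFns : ∀ es (fs : SkolemFns es) β v → v ∈ᵇ map proj₁ es ≡ true
    → extend (map abstractEntry es) (abstractFns es fs) β v ≡ extend es fs (pin β) v
  extend-abstractFns ((y , D) ∷ es) (f ∷ fs) β v v∈es with v ≡ᵇ y
  ... | true  = cong f (restrict-cong D agree)
    where
      D′ = filterᵇ free D

      agree : ∀ {w} → w ∈ D → pin (fromAssign D′ (restrict D′ β)) w ≡ pin β w
      agree {w} w∈D with w ∈ᵇ V′ in w∈V′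
      ... | true  = refl
      ... | false = fromAssign-restrict D′ β (∈-filterᵇ⁺ free w∈D (cong not w∈V′))
  ... | false = extend-abstractFns es fs β v v∈es

  extend-constFns : ∀ ws β v
    → extend (map (λ v → (v , [])) ws) (constFns ws) β v ≡ patch (_∈ᵇ ws) α₀ β v
  extend-constFns []       β v = refl
  extend-constFns (u ∷ ws) β v with v ≡ᵇ u in v≡ᵇu
  ... | true  = cong α₀ (sym (≡ᵇ-sound v≡ᵇu))
  ... | false = extend-constFns ws β v

  V′-⊆-univ : ∀ {w} → w ∈ V′ → w ∈ univ Π
  V′-⊆-univ w∈ with _ , _ , w∈dep ← find (∈-concatMap⁻ (depVar Π ∘ var) {xs = C} w∈) =
    depVar-⊆-univ Π φ wf w∈dep

  pinned-∈ᵇ : ∀ v → v ∈ᵇ pinned ≡ v ∈ᵇ V′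
  pinned-∈ᵇ v with v ∈ᵇ V′ in v∈V′
  ... | true  = ∈⇒∈ᵇ (∈-filterᵇ⁺ (_∈ᵇ V′) (V′-⊆-univ (∈ᵇ⇒∈ {v} v∈V′)) v∈V′)
  ... | false = ¬-not λ v∈pinned →
    true≡false-elim (proj₂ (∈-filterᵇ⁻ (_∈ᵇ V′) (univ Π) (∈ᵇ⇒∈ {v} v∈pinned))) v∈V′

  extend-abstractSkolem : ∀ s β v
    → extend (exist Πₐ) (abstractSkolem s) β v ≡ extend (exist Π) s (pin β) v
  extend-abstractSkolem s β v with isExist Π v in v-exist
  ... | true  = begin
    extend (exist Πₐ) (abstractSkolem s) β v
      ≡⟨ extend-++⁺-in (map abstractEntry (exist Π)) (abstractFns (exist Π) s) (constFns pinned) β v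
           (subst (λ xs → v ∈ᵇ xs ≡ true) (map-∘ (exist Π)) v-exist) ⟩
    extend (map abstractEntry (exist Π)) (abstractFns (exist Π) s) β v
      ≡⟨ extend-abstractFns (exist Π) s β v v-exist ⟩
    extend (exist Π) s (pin β) v ∎
    where open ≡-Reasoning
  ... | false = begin
    extend (exist Πₐ) (abstractSkolem s) β v
      ≡⟨ extend-++⁺-out (map abstractEntry (exist Π)) (abstractFns (exist Π) s) (constFns pinned) β v
           (subst (λ xs → v ∈ᵇ xs ≡ false) (map-∘ (exist Π)) v-exist) ⟩
    extend (map (λ v → (v , [])) pinned) (constFns pinned) β v
      ≡⟨ extend-constFns pinned β v ⟩
    patch (_∈ᵇ pinned) α₀ β v
      ≡⟨ cong (λ b → if b then α₀ v else β v) (pinned-∈ᵇ v) ⟩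
    pin β v
      ≡⟨ extend-nonexist (exist Π) s (pin β) v v-exist ⟨
    extend (exist Π) s (pin β) v ∎
    where open ≡-Reasoning

  Πₐ-disjoint : Disjoint Πₐ
  Πₐ-disjoint {v} v∈univₐ v∈namesₐ
    with v∈univ , v-free ← ∈-filterᵇ⁻ free (univ Π) v∈univₐ
    with e , e∈ , refl ← ∈-map⁻ proj₁ v∈namesₐ
    with ∈-++⁻ (map abstractEntry (exist Π)) e∈
  ... | inj₁ e∈abs with e₀ , e₀∈ , refl ← ∈-map⁻ abstractEntry e∈abs =
    WellFormed.disjoint wf v∈univ (∈-map⁺ proj₁ e₀∈)
  ... | inj₂ e∈const with u , u∈pinned , refl ← ∈-map⁻ (λ v → (v , [])) e∈const =
    true≡false-elim (proj₂ (∈-filterᵇ⁻ (_∈ᵇ V′) (univ Π) u∈pinned)) (not-injective v-free)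

  module _ (compat : Compatible Π C) (s : SkolemFam Π) (sk : IsSkolem Π φ s)
           (C-false : ∀ {ℓ} → ℓ ∈ C → evalLit (extend (exist Π) s α₀) ℓ ≡ false) where

    σ₀ : Var → Bool
    σ₀ = extend (exist Π) s α₀

    pin-agrees-on-C : ∀ β {ℓ} → ℓ ∈ C → extend (exist Π) s (pin β) (var ℓ) ≡ σ₀ (var ℓ)
    pin-agrees-on-C β {ℓ} ℓ∈C = extend-cong (exist Π) s (var ℓ) onDeps onSelf
      where
        pinned-dep : ∀ {w} → w ∈ depVar Π (var ℓ) → pin β w ≡ α₀ w
        pinned-dep w∈ =
          patch-true (_∈ᵇ V′) α₀ β (∈⇒∈ᵇ (∈-concatMap⁺ (depVar Π ∘ var) (lose ℓ∈C w∈)))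

        onDeps : isExist Π (var ℓ) ≡ true
          → ∀ {w} → w ∈ lookupDeps (exist Π) (var ℓ) → pin β w ≡ α₀ w
        onDeps ℓ-exist w∈ =
          pinned-dep (lookupDeps-⊆-depVar Π (WellFormed.disjoint wf) ℓ-exist w∈)

        onSelf : isExist Π (var ℓ) ≡ false → pin β (var ℓ) ≡ α₀ (var ℓ)
        onSelf ℓ-not-exist with ∈-++⁻ (univ Π) (compat ℓ∈C)
        ... | inj₁ ℓ∈univ  = pinned-dep (self-∈-depVar Π ℓ∈univ)
        ... | inj₂ ℓ∈exist = true≡false-elim (∈⇒∈ᵇ ℓ∈exist) ℓ-not-exist

    abstractSkolem-isSkolem : IsSkolem Πₐ (φ ++ negClause C) (abstractSkolem s)
    abstractSkolem-isSkolem = IsSkolem⁺ Πₐ (φ ++ negClause C) sat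
      where
        sat : ∀ {D} → D ∈ φ ++ negClause C → ∀ β → extend (exist Πₐ) (abstractSkolem s) β ⊨ D
        sat {D} D∈ β with ∈-++⁻ φ D∈
        ... | inj₁ D∈φ =
          ⊨-cong (λ v → sym (extend-abstractSkolem s β v)) D (IsSkolem⁻ Π φ sk D∈φ (pin β))
        ... | inj₂ D∈¬C with ℓ , ℓ∈C , refl ← ∈-map⁻ (λ ℓ → neg ℓ ∷ []) D∈¬C =
          any-true⁺ (evalLit σₐ) {xs = neg ℓ ∷ []} (here refl) (begin
            evalLit σₐ (neg ℓ)  ≡⟨ evalLit-neg σₐ ℓ ⟩
            not (evalLit σₐ ℓ)  ≡⟨ cong not (evalLit-cong σₐ σ₀ ℓ σₐ≡σ₀) ⟩
            not (evalLit σ₀ ℓ)  ≡⟨ cong not (C-false ℓ∈C) ⟩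
            true                ∎)
          where
            open ≡-Reasoning

            σₐ : Var → Bool
            σₐ = extend (exist Πₐ) (abstractSkolem s) β

            σₐ≡σ₀ : σₐ (var ℓ) ≡ σ₀ (var ℓ)
            σₐ≡σ₀ = trans (extend-abstractSkolem s β (var ℓ)) (pin-agrees-on-C β ℓ∈C)

DQAT⇒Skolem-satisfies : ∀ Π φ C → WellFormed Π φ → Compatible Π C → DQAT Π φ C
  → ∀ s → IsSkolem Π φ s → ∀ α → extend (exist Π) s α ⊨ C
DQAT⇒Skolem-satisfies Π φ C wf compat dqat s sk α
  with any (evalLit (extend (exist Π) s α)) C in C-value
... | true  = refl
... | false = contradiction (abstractSkolem s , abstractSkolem-isSkolem compat s sk C-false)
                            (Refutes1∀⇒¬HasSkolem Πₐ (φ ++ negClause C) Πₐ-disjoint dqat)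
  where
    open Abstraction Π φ C wf α

    C-false : ∀ {ℓ} → ℓ ∈ C → evalLit (extend (exist Π) s α) ℓ ≡ false
    C-false = any-false⁻ _ C-value

mainTheorem4 : (Π : Prefix) (φ : CNF) (C : Clause)
    → WellFormed Π φ → Compatible Π C → DQAT Π φ C
    → Equivalent Π φ (φ ++ C ∷ [])
mainTheorem4 Π φ C wf compat dqat = record { to = to ; from = from }
  where
    to : ∀ s → IsSkolem Π φ s → IsSkolem Π (φ ++ C ∷ []) s
    to s sk = IsSkolem⁺ Π (φ ++ C ∷ []) λ D∈ → case ∈-++⁻ φ D∈ of λ where
      (inj₁ D∈φ)         → IsSkolem⁻ Π φ sk D∈φ
      (inj₂ (here refl)) → DQAT⇒Skolem-satisfies Π φ C wf compat dqat s sk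

    from : ∀ s → IsSkolem Π (φ ++ C ∷ []) s → IsSkolem Π φ s
    from s sk = IsSkolem⁺ Π φ λ D∈φ → IsSkolem⁻ Π (φ ++ C ∷ []) sk (∈-++⁺ˡ D∈φ)
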